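{- The complete symmetric digraph $K_9^*$ admits a $(\vec{C}_4, \vec{C}_5)$-factorization.
   Context: $K_n^*$ denotes the complete symmetric digraph on $n$ vertices (for every ordered pair of distinct vertices $(u,v)$ there is exactly one arc from $u$ to $v$). $\vec{C}_m$ denotes a directed cycle of length $m$. A directed 2-factor of a digraph $D$ is a spanning subdigraph that is a disjoint union of directed cycles. For $2\le m_1\le\dots\le m_t$ with $m_1+\dots+m_t=n$, a $(\vec{C}_{m_1},\ldots,\vec{C}_{m_t})$-factor of $D$ is a directed 2-factor consisting of $t$ pairwise vertex-disjoint directed cycles of lengths $m_1,\ldots,m_t$; a $(\vec{C}_{m_1},\ldots,\vec{C}_{m_t})$-factorization of $D$ is a partition of the arc set of $D$ into $(\vec{C}_{m_1},\ldots,\vec{C}_{m_t})$-factors. -}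

module Defs where

open import Data.Nat using (ℕ; suc; _≤_)
open import Data.Nat.DivMod using (_mod_)
open import Data.Fin using (Fin; toℕ)
open import Data.Product using (Σ; ∃; _×_; _,_)
open import Data.Sum using (_⊎_)
open import Data.Empty using (⊥)
open import Relation.Nullary using (¬_)
open import Relation.Binary.PropositionalEquality using (_≡_; _≢_)
open import Function.Definitions using (Injective)

IsArcK* : {n : ℕ} → Fin n → Fin n → Set
IsArcK* u v = u ≢ v

next : {k : ℕ} → Fin (suc k) → Fin (suc k)
next {k} i = suc (toℕ i) mod (suc k)

-- A directed cycle of length m = suc k (m ≥ 2) in K_n^*, given by its
-- cyclic vertex sequence, which must consist of distinct vertices.
record DiCycle (n k : ℕ) : Set where
  field
    length≥2 : 2 ≤ suc k
    vtx      : Fin (suc k) → Fin n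
    distinct : Injective _≡_ _≡_ vtx

open DiCycle public

OnCycle : {n k : ℕ} → DiCycle n k → Fin n → Set
OnCycle C v = ∃ λ i → vtx C i ≡ v

CycleArc : {n k : ℕ} → DiCycle n k → Fin n → Fin n → Set
CycleArc C u v = ∃ λ i → vtx C i ≡ u × vtx C (next i) ≡ v

record C4C5Factor (n : ℕ) : Set where
  field
    cyc4     : DiCycle n 3
    cyc5     : DiCycle n 4
    disjoint : ∀ v → OnCycle cyc4 v → OnCycle cyc5 v → ⊥
    spanning : ∀ v → OnCycle cyc4 v ⊎ OnCycle cyc5 v

open C4C5Factor public

FactorArc : {n : ℕ} → C4C5Factor n → Fin n → Fin n → Set
FactorArc F u v = CycleArc (cyc4 F) u v ⊎ CycleArc (cyc5 F) u v

record C4C5Factorization (n : ℕ) : Set where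
  field
    size      : ℕ
    factor    : Fin size → C4C5Factor n
    arcsInK*  : ∀ i u v → FactorArc (factor i) u v → IsArcK* u v
    covers    : ∀ u v → IsArcK* u v → ∃ λ i → FactorArc (factor i) u v
    unique    : ∀ u v i j → FactorArc (factor i) u v → FactorArc (factor j) u v → i ≡ j

-- A 1-rotational factorization. Read the vertex 0 as ∞ and suc x as x ∈ ℤ₈;
-- then the base factor (1 2 6 4)(0 3 5 8 7) is (0 1 5 3)(∞ 2 4 7 6). Its seven
-- arcs avoiding ∞ have the distinct differences 1, 4, 6, 5, 2, 3, 7, and ∞ has
-- one in- and one out-neighbour, so the eight translates x ↦ x + t (fixing ∞)
-- cover every arc of K₉* exactly once.

module Submission where

open import Defs
open import Data.Nat using (ℕ; zero; suc; _+_; _≤_; _≤?_; s≤s)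
open import Data.Nat.DivMod using (_mod_; _%_; m<n⇒m%n≡m; n%n≡0)
open import Data.Nat.Properties using (1+n≢n; <⇒≢; m≤n⇒m<n∨m≡n)
open import Data.Fin using (Fin; toℕ; #_)
open import Data.Fin.Properties using (all?; any?; _≟_; toℕ-fromℕ<; toℕ≤pred[n])
open import Data.Fin.Permutation
  using (Permutation′; permutation; _⟨$⟩ʳ_; _⟨$⟩ˡ_; inverseˡ; inverseʳ; id; lift₀; _∘ₚ_)
open import Data.Vec using (Vec; _∷_; []; lookup)
open import Data.Product using (∃; _,_)
open import Data.Sum using (_⊎_; inj₁; inj₂; [_,_]′) renaming (map to map⊎)
open import Data.Empty using (⊥)
open import Function.Bundles using (Injection)
open import Function.Properties.Inverse using (↔⇒↣)
open import Relation.Nullary using (Dec; no)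
open import Relation.Nullary.Decidable
  using (True; toWitness; _→-dec_; _×-dec_; _⊎-dec_; ¬?)
open import Relation.Binary.PropositionalEquality using (_≡_; _≢_; refl; sym; trans; cong)

suc-mod-suc≢ : ∀ {k} m → 1 ≤ k → m ≤ k → suc m % suc k ≢ m
suc-mod-suc≢ m 1≤k m≤k with m≤n⇒m<n∨m≡n m≤k
... | inj₁ m<k = λ eq → 1+n≢n (trans (sym (m<n⇒m%n≡m (s≤s m<k))) eq)
... | inj₂ refl = λ eq → <⇒≢ 1≤k (trans (sym (n%n≡0 (suc m))) eq)

next≢id : ∀ {k} → 2 ≤ suc k → (i : Fin (suc k)) → next i ≢ i
next≢id (s≤s 1≤k) i next≡i =
  suc-mod-suc≢ (toℕ i) 1≤k (toℕ≤pred[n] i) (trans (sym (toℕ-fromℕ< _)) (cong toℕ next≡i))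

cycleArc⇒arcK* : ∀ {n k} (C : DiCycle n k) {u v} → CycleArc C u v → IsArcK* u v
cycleArc⇒arcK* C (i , refl , refl) u≡v = next≢id (length≥2 C) i (sym (distinct C u≡v))

factorArc⇒arcK* : ∀ {n} (F : C4C5Factor n) {u v} → FactorArc F u v → IsArcK* u v
factorArc⇒arcK* F = [ cycleArc⇒arcK* (cyc4 F) , cycleArc⇒arcK* (cyc5 F) ]′

module _ {n : ℕ} where

  injective? : ∀ {m} (f : Fin m → Fin n) → Dec (∀ x y → f x ≡ f y → x ≡ y)
  injective? f = all? λ x → all? λ y → (f x ≟ f y) →-dec (x ≟ y)

  onCycle? : ∀ {k} (C : DiCycle n k) (v : Fin n) → Dec (OnCycle C v)
  onCycle? C v = any? λ i → vtx C i ≟ v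

  cycleArc? : ∀ {k} (C : DiCycle n k) (u v : Fin n) → Dec (CycleArc C u v)
  cycleArc? C u v = any? λ i → (vtx C i ≟ u) ×-dec (vtx C (next i) ≟ v)

  factorArc? : (F : C4C5Factor n) (u v : Fin n) → Dec (FactorArc F u v)
  factorArc? F u v = cycleArc? (cyc4 F) u v ⊎-dec cycleArc? (cyc5 F) u v

  disjoint? : ∀ {k l} (A : DiCycle n k) (B : DiCycle n l) →
              Dec (∀ v → OnCycle A v → OnCycle B v → ⊥)
  disjoint? A B = all? λ v → onCycle? A v →-dec (onCycle? B v →-dec no (λ ()))

  spanning? : ∀ {k l} (A : DiCycle n k) (B : DiCycle n l) →
              Dec (∀ v → OnCycle A v ⊎ OnCycle B v)
  spanning? A B = all? λ v → onCycle? A v ⊎-dec onCycle? B v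

  covers? : ∀ {s} (F : Fin s → C4C5Factor n) →
            Dec (∀ u v → IsArcK* u v → ∃ λ i → FactorArc (F i) u v)
  covers? F = all? λ u → all? λ v → ¬? (u ≟ v) →-dec any? λ i → factorArc? (F i) u v

  arcsUnique? : ∀ {s} (F : Fin s → C4C5Factor n) →
                Dec (∀ u v i j → FactorArc (F i) u v → FactorArc (F j) u v → i ≡ j)
  arcsUnique? F = all? λ u → all? λ v → all? λ i → all? λ j →
    factorArc? (F i) u v →-dec (factorArc? (F j) u v →-dec (i ≟ j))

  diCycle : ∀ {k} (vs : Vec (Fin n) (suc k))
            {_ : True (2 ≤? suc k)} {_ : True (injective? (lookup vs))} → DiCycle n k
  diCycle vs {len} {inj} = record
    { length≥2 = toWitness len
    ; vtx      = lookup vs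
    ; distinct = λ {x} {y} → toWitness inj x y
    }

  c4c5Factor : (A : DiCycle n 3) (B : DiCycle n 4)
               {_ : True (disjoint? A B)} {_ : True (spanning? A B)} → C4C5Factor n
  c4c5Factor A B {dis} {span} = record
    { cyc4 = A ; cyc5 = B ; disjoint = toWitness dis ; spanning = toWitness span }

  c4c5Factorization : ∀ {s} (F : Fin s → C4C5Factor n)
                      {_ : True (covers? F)} {_ : True (arcsUnique? F)} → C4C5Factorization n
  c4c5Factorization {s} F {cov} {uniq} = record
    { size     = s
    ; factor   = F
    ; arcsInK* = λ i u v → factorArc⇒arcK* (F i)
    ; covers   = toWitness cov
    ; unique   = toWitness uniq
    }

  module _ (π : Permutation′ n) where

    relabelCycle : ∀ {k} → DiCycle n k → DiCycle n k
    relabelCycle C = record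
      { length≥2 = length≥2 C
      ; vtx      = λ i → π ⟨$⟩ʳ vtx C i
      ; distinct = λ eq → distinct C (Injection.injective (↔⇒↣ π) eq)
      }

    onRelabelled⇒onCycle : ∀ {k} (C : DiCycle n k) {v} →
                           OnCycle (relabelCycle C) v → OnCycle C (π ⟨$⟩ˡ v)
    onRelabelled⇒onCycle C (i , refl) = i , sym (inverseˡ π)

    onCycle⇒onRelabelled : ∀ {k} (C : DiCycle n k) {v} →
                           OnCycle C (π ⟨$⟩ˡ v) → OnCycle (relabelCycle C) v
    onCycle⇒onRelabelled C (i , eq) = i , trans (cong (π ⟨$⟩ʳ_) eq) (inverseʳ π)

    relabelFactor : C4C5Factor n → C4C5Factor n
    relabelFactor F = record
      { cyc4     = relabelCycle (cyc4 F)
      ; cyc5     = relabelCycle (cyc5 F)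
      ; disjoint = λ v p q → disjoint F (π ⟨$⟩ˡ v)
          (onRelabelled⇒onCycle (cyc4 F) p) (onRelabelled⇒onCycle (cyc5 F) q)
      ; spanning = λ v → map⊎ (onCycle⇒onRelabelled (cyc4 F)) (onCycle⇒onRelabelled (cyc5 F))
          (spanning F (π ⟨$⟩ˡ v))
      }

rotationℤ₈ : Permutation′ 8
rotationℤ₈ = permutation next previous
  (toWitness {a? = all? λ x → next (previous x) ≟ x} _)
  (toWitness {a? = all? λ x → previous (next x) ≟ x} _)
  where
  previous : Fin 8 → Fin 8
  previous x = (toℕ x + 7) mod 8

translation : ℕ → Permutation′ 9
translation zero    = id
translation (suc t) = lift₀ rotationℤ₈ ∘ₚ translation t

baseFactor : C4C5Factor 9
baseFactor = c4c5Factor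
  (diCycle (# 1 ∷ # 2 ∷ # 6 ∷ # 4 ∷ []))
  (diCycle (# 0 ∷ # 3 ∷ # 5 ∷ # 8 ∷ # 7 ∷ []))

lemma3p1 : C4C5Factorization 9
lemma3p1 = c4c5Factorization {s = 8} λ t → relabelFactor (translation (toℕ t)) baseFactor
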